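{- For every $n\ge3$, $p(n)\ge\mathrm{nbet}(n)$.
   Context: A phylogenetic tree on $[n]$ is a rooted binary tree with leaves labelled bijectively by $[n]$. It is consistent with the triplet $(a|b,c)$ ($a,b,c$ distinct) if the path from leaf $a$ to the root does not intersect the path between leaves $b$ and $c$. $p(n)$ is the minimum size of a set of phylogenetic trees on $[n]$ such that every triplet is consistent with some tree in the set. An ordering of $[n]$ is a bijection $\phi:[n]\to[n]$. It nonbetween-satisfies a triple $(x_1,x_2,x_3)$ of distinct elements unless $\phi(x_1)<\phi(x_2)<\phi(x_3)$ or $\phi(x_3)<\phi(x_2)<\phi(x_1)$. $\mathrm{nbet}(n)$ is the minimum size of a set of orderings of $[n]$ such that every such triple is nonbetween-satisfied by some member. -}

module Defs where

open import Data.Nat using (ℕ; _≤_)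
open import Data.Fin using (Fin; _<_)
open import Data.Bool using (Bool; true; false)
open import Data.List using (List; []; _∷_; _++_; allFin)
open import Data.List.Relation.Binary.Permutation.Propositional using (_↭_)
open import Data.Fin.Permutation using (Permutation′; _⟨$⟩ʳ_)
open import Data.Product using (Σ; ∃; _×_)
open import Data.Sum using (_⊎_)
open import Relation.Nullary using (¬_)
open import Relation.Binary.PropositionalEquality using (_≡_; _≢_)

data Tree (n : ℕ) : Set where
  leaf : Fin n → Tree n
  node : Tree n → Tree n → Tree n

leaves : ∀ {n} → Tree n → List (Fin n)
leaves (leaf x)   = x ∷ []
leaves (node l r) = leaves l ++ leaves r

PhyloTree : ℕ → Set
PhyloTree n = Σ (Tree n) (λ t → leaves t ↭ allFin n)

-- Vertices of a tree are addressed by the path from the root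
-- (false = left child, true = right child).
Addr : Set
Addr = List Bool

data LeafAt {n : ℕ} : Tree n → Addr → Fin n → Set where
  here  : ∀ {x} → LeafAt (leaf x) [] x
  left  : ∀ {l r p x} → LeafAt l p x → LeafAt (node l r) (false ∷ p) x
  right : ∀ {l r p x} → LeafAt r p x → LeafAt (node l r) (true ∷ p) x

data _⊑_ : Addr → Addr → Set where
  []⊑ : ∀ {w} → [] ⊑ w
  ∷⊑  : ∀ {b v w} → v ⊑ w → (b ∷ v) ⊑ (b ∷ w)

lca : Addr → Addr → Addr
lca (false ∷ v) (false ∷ w) = false ∷ lca v w
lca (true ∷ v)  (true ∷ w)  = true ∷ lca v w
lca _ _ = []

OnRootPath : Addr → Addr → Set
OnRootPath a v = v ⊑ a

OnPath : Addr → Addr → Addr → Set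
OnPath b c v = lca b c ⊑ v × (v ⊑ b ⊎ v ⊑ c)

Consistent : ∀ {n} → Tree n → Fin n → Fin n → Fin n → Set
Consistent t a b c =
  ∃ λ pa → ∃ λ pb → ∃ λ pc →
    LeafAt t pa a × LeafAt t pb b × LeafAt t pc c ×
    (∀ v → OnRootPath pa v → ¬ OnPath pb pc v)

Distinct3 : ∀ {n} → Fin n → Fin n → Fin n → Set
Distinct3 a b c = a ≢ b × a ≢ c × b ≢ c

TreeCover : (n k : ℕ) → (Fin k → PhyloTree n) → Set
TreeCover n k T =
  ∀ a b c → Distinct3 a b c → ∃ λ i → Consistent (Σ.proj₁ (T i)) a b c

IsP : ℕ → ℕ → Set
IsP n k = (∃ λ T → TreeCover n k T) × (∀ m (T : Fin m → PhyloTree n) → TreeCover n m T → k ≤ m)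

NonbetweenSat : ∀ {n} → Permutation′ n → Fin n → Fin n → Fin n → Set
NonbetweenSat φ x₁ x₂ x₃ =
  ¬ (((φ ⟨$⟩ʳ x₁) < (φ ⟨$⟩ʳ x₂) × (φ ⟨$⟩ʳ x₂) < (φ ⟨$⟩ʳ x₃)) ⊎
     ((φ ⟨$⟩ʳ x₃) < (φ ⟨$⟩ʳ x₂) × (φ ⟨$⟩ʳ x₂) < (φ ⟨$⟩ʳ x₁)))

OrderCover : (n k : ℕ) → (Fin k → Permutation′ n) → Set
OrderCover n k Φ =
  ∀ x₁ x₂ x₃ → Distinct3 x₁ x₂ x₃ → ∃ λ i → NonbetweenSat (Φ i) x₁ x₂ x₃

IsNbet : ℕ → ℕ → Set
IsNbet n k = (∃ λ Φ → OrderCover n k Φ) × (∀ m (Φ : Fin m → Permutation′ n) → OrderCover n m Φ → k ≤ m)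

module Submission where

-- Every phylogenetic tree T on [n] determines an ordering φ_T of [n]: read its
-- leaves from left to right.  If T is consistent with the triplet (a|b,c) then
-- a is NOT between b and c in φ_T: were it between, the leaf a would lie below
-- the lowest common ancestor of b and c, which is a vertex on the path from a to
-- the root and on the path between b and c.  Hence a family of trees covering
-- all triplets yields, tree by tree, an equally large family of orderings that
-- nonbetween-satisfies every triple (x₁,x₂,x₃) (use the triplet (x₂|x₁,x₃)),
-- and minimality of nbet(n) gives nbet(n) ≤ p(n).

open import Defs
open import Data.Nat using (ℕ; suc; _+_; _≤_; _<_; s≤s; z≤n)
open import Data.Nat.Properties
  using (<⇒≱; <⇒≤; <-trans; ≤-trans; +-cancelˡ-<; m≤m+n)
open import Data.Fin using (Fin; toℕ; cast)
open import Data.Fin.Properties using (toℕ-injective; toℕ-cast; cast-involutive)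
open import Data.Fin.Permutation using (Permutation′; _⟨$⟩ʳ_; permutation)
open import Data.List using (List; []; _∷_; _++_; length; lookup)
open import Data.List.Properties using (length-tabulate)
open import Data.List.Membership.Propositional using (_∈_)
open import Data.List.Membership.Propositional.Properties using (∈-allFin)
open import Data.List.Relation.Unary.Any using (here; there; index)
open import Data.List.Relation.Unary.Any.Properties using (lookup-index)
open import Data.List.Relation.Unary.All as All using ()
open import Data.List.Relation.Unary.AllPairs using (_∷_)
open import Data.List.Relation.Unary.Unique.Propositional using (Unique)
open import Data.List.Relation.Unary.Unique.Propositional.Properties using (allFin⁺)
open import Data.List.Relation.Binary.Permutation.Propositional using (↭-sym; ↭⇒↭ₛ)
open import Data.List.Relation.Binary.Permutation.Propositional.Properties
  using (∈-resp-↭; ↭-length)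
import Data.List.Relation.Binary.Permutation.Setoid.Properties as Setoid↭
open import Data.Product using (_×_; _,_; proj₁; proj₂)
open import Data.Sum using (_⊎_; inj₁; inj₂)
open import Data.Empty using (⊥-elim)
open import Data.Bool using (true; false)
open import Relation.Binary.PropositionalEquality
  using (_≡_; refl; sym; trans; cong; setoid; ≢-sym; module ≡-Reasoning)

data At {A : Set} : List A → ℕ → A → Set where
  at-head : ∀ {x xs} → At (x ∷ xs) 0 x
  at-tail : ∀ {x xs k y} → At xs k y → At (x ∷ xs) (suc k) y

At⇒∈ : ∀ {A : Set} {xs : List A} {k y} → At xs k y → y ∈ xs
At⇒∈ at-head     = here refl
At⇒∈ (at-tail a) = there (At⇒∈ a)

At-bound : ∀ {A : Set} {xs : List A} {k y} → At xs k y → k < length xs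
At-bound at-head     = s≤s z≤n
At-bound (at-tail a) = s≤s (At-bound a)

At-++ˡ : ∀ {A : Set} {xs : List A} ys {k y} → At xs k y → At (xs ++ ys) k y
At-++ˡ ys at-head     = at-head
At-++ˡ ys (at-tail a) = at-tail (At-++ˡ ys a)

At-++ʳ : ∀ {A : Set} (xs : List A) {ys k y} → At ys k y → At (xs ++ ys) (length xs + k) y
At-++ʳ []       a = a
At-++ʳ (x ∷ xs) a = at-tail (At-++ʳ xs a)

At-lookup : ∀ {A : Set} (xs : List A) (i : Fin (length xs)) → At xs (toℕ i) (lookup xs i)
At-lookup (x ∷ xs) Fin.zero    = at-head
At-lookup (x ∷ xs) (Fin.suc i) = at-tail (At-lookup xs i)

At-index : ∀ {A : Set} {xs : List A} {y} (y∈xs : y ∈ xs) → At xs (toℕ (index y∈xs)) y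
At-index (here refl)  = at-head
At-index (there y∈xs) = at-tail (At-index y∈xs)

At-unique : ∀ {A : Set} {xs : List A} {k k′ y} → Unique xs → At xs k y → At xs k′ y → k ≡ k′
At-unique _            at-head     at-head     = refl
At-unique (x∉xs ∷ _)   at-head     (at-tail b) = ⊥-elim (All.lookup x∉xs (At⇒∈ b) refl)
At-unique (x∉xs ∷ _)   (at-tail a) at-head     = ⊥-elim (All.lookup x∉xs (At⇒∈ a) refl)
At-unique (_ ∷ unique) (at-tail a) (at-tail b) = cong suc (At-unique unique a b)

module Enumeration {n : ℕ} (L : List (Fin n)) (unique : Unique L) (complete : ∀ x → x ∈ L)
                   (|L|≡n : length L ≡ n) where

  open ≡-Reasoning

  position : Fin n → Fin n
  position x = cast |L|≡n (index (complete x))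

  element : Fin n → Fin n
  element i = lookup L (cast (sym |L|≡n) i)

  position-spec : ∀ {k x} → At L k x → toℕ (position x) ≡ k
  position-spec {x = x} a =
    trans (toℕ-cast |L|≡n (index (complete x))) (At-unique unique (At-index (complete x)) a)

  position-element : ∀ i → position (element i) ≡ i
  position-element i = toℕ-injective (begin
    toℕ (position (element i))  ≡⟨ position-spec (At-lookup L (cast (sym |L|≡n) i)) ⟩
    toℕ (cast (sym |L|≡n) i)    ≡⟨ toℕ-cast (sym |L|≡n) i ⟩
    toℕ i                       ∎)

  element-position : ∀ x → element (position x) ≡ x
  element-position x = begin
    lookup L (cast (sym |L|≡n) (cast |L|≡n (index (complete x))))
      ≡⟨ cong (lookup L) (cast-involutive (sym |L|≡n) |L|≡n (index (complete x))) ⟩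
    lookup L (index (complete x))
      ≡⟨ sym (lookup-index (complete x)) ⟩
    x ∎

  ordering : Permutation′ n
  ordering = permutation position element position-element element-position

module LeafOrder {n : ℕ} (T : PhyloTree n) where
  open Enumeration (leaves (proj₁ T))
    (Setoid↭.Unique-resp-↭ (setoid (Fin n)) (↭⇒↭ₛ (↭-sym (proj₂ T))) (allFin⁺ n))
    (λ x → ∈-resp-↭ (↭-sym (proj₂ T)) (∈-allFin x))
    (trans (↭-length (proj₂ T)) (length-tabulate (λ i → i)))
    public

leafOrder : ∀ {n} → PhyloTree n → Permutation′ n
leafOrder T = LeafOrder.ordering T

leafPosition : ∀ {n} {t : Tree n} {p x} → LeafAt t p x → ℕ
leafPosition here              = 0
leafPosition (left h)          = leafPosition h
leafPosition (right {l = l} h) = length (leaves l) + leafPosition h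

leafPosition-At : ∀ {n} {t : Tree n} {p x} (h : LeafAt t p x) → At (leaves t) (leafPosition h) x
leafPosition-At here              = at-head
leafPosition-At (left {r = r} h)  = At-++ˡ (leaves r) (leafPosition-At h)
leafPosition-At (right {l = l} h) = At-++ʳ (leaves l) (leafPosition-At h)

-- A leaf position is smaller than the number of leaves; applied to a subtree,
-- this says that the leaves of a left subtree precede those of its sibling.
leafPosition-bound : ∀ {n} {t : Tree n} {p x} (h : LeafAt t p x) → leafPosition h < length (leaves t)
leafPosition-bound h = At-bound (leafPosition-At h)

leafOrder-position : ∀ {n} (T : PhyloTree n) {p x} (h : LeafAt (proj₁ T) p x) →
                     toℕ (leafOrder T ⟨$⟩ʳ x) ≡ leafPosition h
leafOrder-position T h = LeafOrder.position-spec T (leafPosition-At h)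

Between : ℕ → ℕ → ℕ → Set
Between x y z = (x < y × y < z) ⊎ (z < y × y < x)

Between-resp : ∀ {x x′ y y′ z z′} → x ≡ x′ → y ≡ y′ → z ≡ z′ → Between x y z → Between x′ y′ z′
Between-resp refl refl refl β = β

Between-unshift : ∀ m {x y z} → Between (m + x) (m + y) (m + z) → Between x y z
Between-unshift m (inj₁ (x<y , y<z)) = inj₁ (+-cancelˡ-< m _ _ x<y , +-cancelˡ-< m _ _ y<z)
Between-unshift m (inj₂ (z<y , y<x)) = inj₂ (+-cancelˡ-< m _ _ z<y , +-cancelˡ-< m _ _ y<x)

Between-below : ∀ {m x y z} → x < m → z < m → Between x y z → y < m
Between-below _   z<m (inj₁ (_ , y<z)) = <-trans y<z z<m
Between-below x<m _   (inj₂ (_ , y<x)) = <-trans y<x x<m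

Between-above : ∀ {m x y z} → m ≤ x → m ≤ z → Between x y z → m ≤ y
Between-above m≤x _   (inj₁ (x<y , _)) = ≤-trans m≤x (<⇒≤ x<y)
Between-above _   m≤z (inj₂ (z<y , _)) = ≤-trans m≤z (<⇒≤ z<y)

⊑-refl : ∀ v → v ⊑ v
⊑-refl []      = []⊑
⊑-refl (b ∷ v) = ∷⊑ (⊑-refl v)

lca-⊑ˡ : ∀ v w → lca v w ⊑ v
lca-⊑ˡ (false ∷ v) (false ∷ w) = ∷⊑ (lca-⊑ˡ v w)
lca-⊑ˡ (true ∷ v)  (true ∷ w)  = ∷⊑ (lca-⊑ˡ v w)
lca-⊑ˡ []          _           = []⊑
lca-⊑ˡ (false ∷ v) []          = []⊑
lca-⊑ˡ (false ∷ v) (true ∷ w)  = []⊑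
lca-⊑ˡ (true ∷ v)  []          = []⊑
lca-⊑ˡ (true ∷ v)  (false ∷ w) = []⊑

-- The leaves of a subtree form a contiguous block of the leaf order, so a leaf
-- lying between the leaves b and c lies in the subtree rooted at their lca.
-- Descend to the subtree where b and c split; a cannot have left it earlier,
-- since the block of a subtree containing b and c contains everything between.
between⇒below-lca : ∀ {n} {t : Tree n} {pa pb pc a b c}
  (ha : LeafAt t pa a) (hb : LeafAt t pb b) (hc : LeafAt t pc c) →
  Between (leafPosition hb) (leafPosition ha) (leafPosition hc) → lca pb pc ⊑ pa
between⇒below-lca here here here _ = []⊑
between⇒below-lca ha (left hb)  (right hc) _ = []⊑
between⇒below-lca ha (right hb) (left hc)  _ = []⊑
between⇒below-lca (left ha) (left hb) (left hc) β = ∷⊑ (between⇒below-lca ha hb hc β)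
between⇒below-lca (right {l = l} ha) (right hb) (right hc) β =
  ∷⊑ (between⇒below-lca ha hb hc (Between-unshift (length (leaves l)) β))
between⇒below-lca (right {l = l} ha) (left hb) (left hc) β =
  ⊥-elim (<⇒≱ (Between-below (leafPosition-bound hb) (leafPosition-bound hc) β)
              (m≤m+n (length (leaves l)) (leafPosition ha)))
between⇒below-lca (left {l = l} ha) (right hb) (right hc) β =
  ⊥-elim (<⇒≱ (leafPosition-bound ha)
              (Between-above (m≤m+n (length (leaves l)) (leafPosition hb))
                             (m≤m+n (length (leaves l)) (leafPosition hc)) β))

-- Consistency with (a|b,c) forbids a between b and c in the leaf order: the lca
-- of b and c is on the path between b and c, so it is not an ancestor of a.
consistent⇒nonbetween : ∀ {n} (T : PhyloTree n) {a b c} →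
  Consistent (proj₁ T) a b c → NonbetweenSat (leafOrder T) b a c
consistent⇒nonbetween T (pa , pb , pc , ha , hb , hc , avoids) β =
  avoids (lca pb pc) lca⊑pa (⊑-refl (lca pb pc) , inj₁ (lca-⊑ˡ pb pc))
  where
    lca⊑pa : lca pb pc ⊑ pa
    lca⊑pa = between⇒below-lca ha hb hc
      (Between-resp (leafOrder-position T hb) (leafOrder-position T ha) (leafOrder-position T hc) β)

treeCover⇒orderCover : ∀ {n k} (T : Fin k → PhyloTree n) →
  TreeCover n k T → OrderCover n k (λ i → leafOrder (T i))
treeCover⇒orderCover T cover x₁ x₂ x₃ (x₁≢x₂ , x₁≢x₃ , x₂≢x₃) =
  let (i , consistent) = cover x₂ x₁ x₃ (≢-sym x₁≢x₂ , x₂≢x₃ , x₁≢x₃)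
  in i , consistent⇒nonbetween (T i) consistent

-- nbet(n) ≤ p(n): the leaf orders of an optimal tree family form an order
-- cover of the same size.  (The argument does not need n ≥ 3.)
lemma5p6 : ∀ n → 3 ≤ n → ∀ p nb → IsP n p → IsNbet n nb → nb ≤ p
lemma5p6 n _ p nb ((T , cover) , _) (_ , nbet-minimal) =
  nbet-minimal p (λ i → leafOrder (T i)) (treeCover⇒orderCover T cover)
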